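{- Let $\mathcal{G}$ be a family of simple graphs on a fixed finite vertex set $V$ such that for every $G'\in\mathcal{G}$ and all $x,y\in V$ the compression $G'_{x\to y}$ also belongs to $\mathcal{G}$. Suppose $G\in\mathcal{G}$ satisfies $d_2(G)=\max\{d_2(G'):G'\in\mathcal{G}\}$. Then $G$ is a threshold graph.
   Context: For a graph $G$ and vertices $x,y$, let $N_G(x,\overline{y})=\{v\in V(G)\setminus\{x,y\}: v\sim x,\ v\not\sim y\}$. The compression $G_{x\to y}$ is the graph obtained from $G$ by deleting all edges between $x$ and $N_G(x,\overline{y})$ and adding all edges from $y$ to $N_G(x,\overline{y})$. $d_2(G)=\sum_{v\in V(G)} d(v)^2$. A simple graph $G$ is a threshold graph if there exist $w:V(G)\to\mathbb{R}$ and $t\in\mathbb{R}$ such that for distinct $x,y$, $xy\in E(G)$ iff $w(x)+w(y)\ge t$. -}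

module Defs where

open import Data.Bool using (Bool; true; false; _∧_; _∨_; not; if_then_else_)
open import Data.Nat using (ℕ; _+_; _*_)
open import Data.Fin using (Fin; _≟_)
open import Data.List using (List; map; allFin)
open import Data.Nat.ListAction using (sum)
open import Data.Product using (Σ; _×_)
open import Data.Rational using (ℚ) renaming (_+_ to _+ℚ_; _≤_ to _≤ℚ_)
open import Relation.Nullary using (¬_)
open import Relation.Nullary.Decidable using (⌊_⌋)
open import Relation.Binary.PropositionalEquality using (_≡_)
open import Function.Bundles using (_⇔_)

Adj : ℕ → Set
Adj n = Fin n → Fin n → Bool

IsSimple : ∀ {n} → Adj n → Set
IsSimple {n} G = (∀ (x y : Fin n) → G x y ≡ G y x) × (∀ (x : Fin n) → G x x ≡ false)

_==_ : ∀ {n} → Fin n → Fin n → Bool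
x == y = ⌊ x ≟ y ⌋

-- v ∈ N_G(x, ȳ) : v ∉ {x,y}, v ~ x, v ≁ y.
inN : ∀ {n} → Adj n → Fin n → Fin n → Fin n → Bool
inN G x y v = not (v == x) ∧ not (v == y) ∧ G x v ∧ not (G y v)

-- The compression G_{x→y}: delete all edges between x and N_G(x,ȳ),
-- add all edges between y and N_G(x,ȳ).
compress : ∀ {n} → Adj n → Fin n → Fin n → Adj n
compress G x y u v =
  (G u v ∧ not (((u == x) ∧ inN G x y v) ∨ ((v == x) ∧ inN G x y u)))
  ∨ (((u == y) ∧ inN G x y v) ∨ ((v == y) ∧ inN G x y u))

deg : ∀ {n} → Adj n → Fin n → ℕ
deg {n} G v = sum (map (λ u → if G v u then 1 else 0) (allFin n))

d₂ : ∀ {n} → Adj n → ℕ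
d₂ {n} G = sum (map (λ v → deg G v * deg G v) (allFin n))

IsThreshold : ∀ {n} → Adj n → Set
IsThreshold {n} G =
  Σ (Fin n → ℚ) λ w → Σ ℚ λ t →
    ∀ (x y : Fin n) → ¬ (x ≡ y) → (G x y ≡ true ⇔ t ≤ℚ (w x +ℚ w y))

module Submission where

-- For x ≠ y let a = |N(x,ȳ)|.  A pointwise identity for
--     the adjacency of G_{x→y}, summed over one endpoint, shows that the
--     compression moves a units of degree from x to y and fixes all other
--     degrees.  With the balance  d(x) + |N(y,x̄)| = d(y) + |N(x,ȳ)|  and the
--     exchange inequality (e+a)² + d² < e² + (d+a)² for e < d, a > 0, this
--     gives d₂(G_{x→y}) > d₂(G) whenever N(x,ȳ) and N(y,x̄) are both
--     non-empty.  So a d₂-maximiser has nested neighbourhoods.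
-- (2) Nested ⇒ threshold.  Then the neighbourhood of x is closed upwards in
--     degree, so with φ(x) the least degree of a neighbour of x (n if x is
--     isolated), x ∼ y ⇔ φ(x) ≤ d(y) for x ≠ y.  Such a level description is
--     realised by the weights w(v) = d(v) + (n ∸ φ(v)) and threshold 2n.

open import Defs
open import Data.Bool using (Bool; true; false; _∧_; _∨_; not; if_then_else_)
open import Data.Bool.Properties using (¬-not)
open import Data.Empty using (⊥)
open import Data.Fin using (Fin; zero; suc; _≟_)
open import Data.Fin.Properties using (suc-injective)
import Data.Integer as ℤ
import Data.Integer.Properties as ℤP
open import Data.List using (map; allFin; tabulate)
open import Data.List.Properties using (map-tabulate)
open import Data.List.Extrema.Nat using (argmin; f[argmin]≤f[xs])
open import Data.List.Membership.Propositional.Properties using (∈-allFin)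
import Data.List.Relation.Unary.All as All
import Data.Nat.ListAction as List
open import Data.Nat using (ℕ; zero; suc; _+_; _*_; _∸_; _≤_; _<_; z≤n; s≤s)
open import Data.Nat.Properties
  using ( +-0-commutativeMonoid; +-assoc; +-comm; +-identityʳ; ≤-refl; <⇒≱; ≰⇒>
        ; +-mono-≤; +-monoˡ-≤; +-mono-<; +-monoˡ-<; +-monoʳ-<; +-mono-<-≤; +-mono-≤-<
        ; +-cancelʳ-≡; +-cancelʳ-<; *-monoˡ-<; *-monoʳ-<; m<m+n; m+[n∸m]≡n
        ; module ≤-Reasoning )
open import Data.Nat.Divisibility using (∣1⇒≡1)
open import Data.Nat.Solver using (module +-*-Solver)
open import Data.Product using (_×_; _,_; proj₁; proj₂)
open import Data.Rational using (ℚ; mkℚ; *≤*) renaming (_+_ to _+ℚ_; _≤_ to _≤ℚ_)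
import Data.Rational.Properties as ℚP
import Data.Rational.Unnormalised as ℚᵘ
import Data.Rational.Unnormalised.Properties as ℚᵘP
open import Function using (id; _∘_; _⇔_; mk⇔; module Equivalence)
open import Relation.Nullary using (yes; no; contradiction)
open import Relation.Nullary.Decidable using (isYes≗does; dec-true; dec-false)
open import Relation.Binary.PropositionalEquality
open import Algebra.Properties.CommutativeMonoid.Sum +-0-commutativeMonoid
  using (sum; sum-cong-≗; ∑-distrib-+; sum-replicate-zero)

open +-*-Solver using (solve; _:+_; _:*_; _:=_; con)

ind : Bool → ℕ
ind b = if b then 1 else 0

ind-∨ : ∀ p q → (p ≡ true → q ≡ false) → ind (p ∨ q) ≡ ind p + ind q
ind-∨ true  true  p⇒¬q = contradiction (p⇒¬q refl) λ ()
ind-∨ true  false _    = refl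
ind-∨ false q     _    = refl

ind-delete-add : ∀ g r d → (r ≡ true → g ≡ true) → (d ≡ true → g ≡ false) →
                 ind ((g ∧ not r) ∨ d) + ind r ≡ ind g + ind d
ind-delete-add true  true  true  _   d⇒¬g = contradiction (d⇒¬g refl) λ ()
ind-delete-add true  true  false _   _    = refl
ind-delete-add true  false true  _   d⇒¬g = contradiction (d⇒¬g refl) λ ()
ind-delete-add true  false false _   _    = refl
ind-delete-add false true  _     r⇒g _    = contradiction (r⇒g refl) λ ()
ind-delete-add false false true  _   _    = refl
ind-delete-add false false false _   _    = refl

∨-elim : ∀ {A : Set} p q → (p ≡ true → A) → (q ≡ true → A) → (p ∨ q) ≡ true → A
∨-elim true  _ onp _   _ = onp refl
∨-elim false _ _   onq h = onq h

guard-true : ∀ {b a} → b ≡ true → (if b then a else 0) ≡ a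
guard-true refl = refl

guard-false : ∀ {b a} → b ≡ false → (if b then a else 0) ≡ 0
guard-false refl = refl

==-refl : ∀ {n} (x : Fin n) → (x == x) ≡ true
==-refl x = trans (isYes≗does (x ≟ x)) (dec-true (x ≟ x) refl)

==-≢ : ∀ {n} {x y : Fin n} → x ≢ y → (x == y) ≡ false
==-≢ {x = x} {y} x≢y = trans (isYes≗does (x ≟ y)) (dec-false (x ≟ y) x≢y)

==-suc : ∀ {n} (u w : Fin n) → (suc u == suc w) ≡ (u == w)
==-suc u w with u ≟ w
... | yes _ = refl
... | no  _ = refl

==-∧ : ∀ {n} {u w : Fin n} {b} → (u == w ∧ b) ≡ true → u ≡ w × b ≡ true
==-∧ {u = u} {w} h with u ≟ w
... | yes u≡w = u≡w , h
... | no  _   = contradiction h λ ()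

sum-allFin : ∀ {n} (f : Fin n → ℕ) → List.sum (map f (allFin n)) ≡ sum f
sum-allFin f = trans (cong List.sum (map-tabulate id f)) (sum-tabulate f)
  where
  sum-tabulate : ∀ {m} (g : Fin m → ℕ) → List.sum (tabulate g) ≡ sum g
  sum-tabulate {zero}  g = refl
  sum-tabulate {suc m} g = cong (g zero +_) (sum-tabulate (g ∘ suc))

sum-ones : ∀ n → sum {n} (λ _ → 1) ≡ n
sum-ones zero    = refl
sum-ones (suc n) = cong suc (sum-ones n)

sum-mono : ∀ {n} {f g : Fin n → ℕ} → (∀ i → f i ≤ g i) → sum f ≤ sum g
sum-mono {zero}  _   = z≤n
sum-mono {suc n} f≤g = +-mono-≤ (f≤g zero) (sum-mono (f≤g ∘ suc))

sum-mono-< : ∀ {n} {f g : Fin n → ℕ} → (∀ i → f i ≤ g i) →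
             (p : Fin n) → f p < g p → sum f < sum g
sum-mono-< f≤g zero    fp<gp = +-mono-<-≤ fp<gp (sum-mono (f≤g ∘ suc))
sum-mono-< f≤g (suc p) fp<gp = +-mono-≤-< (f≤g zero) (sum-mono-< (f≤g ∘ suc) p fp<gp)

sum-split₃ : ∀ {n} (f g h : Fin n → ℕ) →
             sum (λ v → f v + g v + h v) ≡ sum f + sum g + sum h
sum-split₃ f g h = trans (∑-distrib-+ _ h) (cong (_+ sum h) (∑-distrib-+ f g))

sum-guard : ∀ {n} b (f : Fin n → Bool) →
            sum (λ v → ind (b ∧ f v)) ≡ (if b then sum (ind ∘ f) else 0)
sum-guard     true  f = refl
sum-guard {n} false f = sum-replicate-zero n

sum-indicator : ∀ {n} (p : Fin n) c → sum (λ v → ind (v == p ∧ c)) ≡ ind c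
sum-indicator {suc n} zero    c = trans (cong (ind c +_) (sum-replicate-zero n)) (+-identityʳ (ind c))
sum-indicator {suc n} (suc p) c = begin
  sum (λ v → ind (v == suc p ∧ c))          ≡⟨⟩
  sum (λ v → ind (suc v == suc p ∧ c))      ≡⟨ sum-cong-≗ (λ v → cong (λ b → ind (b ∧ c)) (==-suc v p)) ⟩
  sum (λ v → ind (v == p ∧ c))              ≡⟨ sum-indicator p c ⟩
  ind c                                     ∎
  where open ≡-Reasoning

sum-agree-off : ∀ {n} {f g : Fin n → ℕ} (p : Fin n) →
                (∀ u → u ≢ p → f u ≡ g u) → sum f + g p ≡ sum g + f p
sum-agree-off {suc n} {f} {g} zero agree = begin
  f zero + sum (f ∘ suc) + g zero ≡⟨ cong (λ s → f zero + s + g zero) tails ⟩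
  f zero + sum (g ∘ suc) + g zero ≡⟨ swap-ends (f zero) (sum (g ∘ suc)) (g zero) ⟩
  g zero + sum (g ∘ suc) + f zero ∎
  where
  open ≡-Reasoning
  tails : sum (f ∘ suc) ≡ sum (g ∘ suc)
  tails = sum-cong-≗ (λ u → agree (suc u) λ ())
  swap-ends : ∀ a s b → a + s + b ≡ b + s + a
  swap-ends = solve 3 (λ a s b → a :+ s :+ b := b :+ s :+ a) refl
sum-agree-off {suc n} {f} {g} (suc p) agree = begin
  f zero + sum (f ∘ suc) + g (suc p)   ≡⟨ +-assoc (f zero) _ _ ⟩
  f zero + (sum (f ∘ suc) + g (suc p)) ≡⟨ cong₂ _+_ (agree zero λ ()) tails ⟩
  g zero + (sum (g ∘ suc) + f (suc p)) ≡⟨ +-assoc (g zero) _ _ ⟨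
  g zero + sum (g ∘ suc) + f (suc p)   ∎
  where
  open ≡-Reasoning
  tails : sum (f ∘ suc) + g (suc p) ≡ sum (g ∘ suc) + f (suc p)
  tails = sum-agree-off p (λ u u≢p → agree (suc u) (u≢p ∘ suc-injective))

sum-agree-off₂ : ∀ {n} {f g : Fin n → ℕ} {x y : Fin n} → x ≢ y →
                 (∀ u → u ≢ x → u ≢ y → f u ≡ g u) →
                 sum f + (g x + g y) ≡ sum g + (f x + f y)
sum-agree-off₂ {n} {f} {g} {x} {y} x≢y agree = begin
  sum f + (g x + g y) ≡⟨ cong (sum f +_) (+-comm (g x) (g y)) ⟩
  sum f + (g y + g x) ≡⟨ +-assoc (sum f) (g y) (g x) ⟨
  sum f + g y + g x   ≡⟨ cong (λ t → sum f + t + g x) h-at-y ⟨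
  sum f + h y + g x   ≡⟨ cong (_+ g x) (sum-agree-off y f≈h) ⟩
  sum h + f y + g x   ≡⟨ +-assoc (sum h) (f y) (g x) ⟩
  sum h + (f y + g x) ≡⟨ cong (sum h +_) (+-comm (f y) (g x)) ⟩
  sum h + (g x + f y) ≡⟨ +-assoc (sum h) (g x) (f y) ⟨
  sum h + g x + f y   ≡⟨ cong (_+ f y) (sum-agree-off x (λ u → h-off-x)) ⟩
  sum g + h x + f y   ≡⟨ cong (λ t → sum g + t + f y) h-at-x ⟩
  sum g + f x + f y   ≡⟨ +-assoc (sum g) (f x) (f y) ⟩
  sum g + (f x + f y) ∎
  where
  open ≡-Reasoning
  -- h agrees with f off y and with g off x.
  h : Fin n → ℕ
  h u = if u == x then f x else g u
  h-at-x : h x ≡ f x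
  h-at-x = cong (λ b → if b then f x else g x) (==-refl x)
  h-off-x : ∀ {u} → u ≢ x → h u ≡ g u
  h-off-x {u} u≢x = cong (λ b → if b then f x else g u) (==-≢ u≢x)
  h-at-y : h y ≡ g y
  h-at-y = h-off-x (x≢y ∘ sym)
  f≈h : ∀ u → u ≢ y → f u ≡ h u
  f≈h u u≢y with u ≟ x
  ... | yes refl = refl
  ... | no  u≢x  = agree u u≢x u≢y

square : ℕ → ℕ
square k = k * k

square-exchange : ∀ {e d a} → e < d → 0 < a →
                  square (e + a) + square d < square e + square (d + a)
square-exchange {e} {d} {suc a′} e<d _ = +-cancelʳ-< (2 * (e * a)) _ _ (begin-strict
    square (e + a) + square d + 2 * (e * a)
      <⟨ +-monoʳ-< (square (e + a) + square d) (*-monoʳ-< 2 (*-monoˡ-< a e<d)) ⟩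
    square (e + a) + square d + 2 * (d * a)
      ≡⟨ expand e d a ⟩
    square e + square (d + a) + 2 * (e * a) ∎)
  where
  open ≤-Reasoning
  a : ℕ
  a = suc a′
  expand : ∀ e d a → (e + a) * (e + a) + d * d + 2 * (d * a) ≡ e * e + (d + a) * (d + a) + 2 * (e * a)
  expand = solve 3 (λ e d a → (e :+ a) :* (e :+ a) :+ d :* d :+ con 2 :* (d :* a)
                             := e :* e :+ (d :+ a) :* (d :+ a) :+ con 2 :* (e :* a)) refl

budget-split : ∀ {B p q} → p ≤ B → q ≤ B → B + B ≡ (p + (B ∸ q)) + (q + (B ∸ p))
budget-split {B} {p} {q} p≤B q≤B = begin
  B + B                         ≡⟨ cong₂ _+_ (m+[n∸m]≡n q≤B) (m+[n∸m]≡n p≤B) ⟨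
  (q + (B ∸ q)) + (p + (B ∸ p)) ≡⟨ swap q (B ∸ q) p (B ∸ p) ⟩
  (p + (B ∸ q)) + (q + (B ∸ p)) ∎
  where
  open ≡-Reasoning
  swap : ∀ a b c d → (a + b) + (c + d) ≡ (c + b) + (a + d)
  swap = solve 4 (λ a b c d → (a :+ b) :+ (c :+ d) := (c :+ b) :+ (a :+ d)) refl

levels-met : ∀ {B p q dx dy} → p ≤ B → q ≤ B → p ≤ dy → q ≤ dx →
             B + B ≤ (dx + (B ∸ p)) + (dy + (B ∸ q))
levels-met {B} {p} {q} {dx} {dy} p≤B q≤B p≤dy q≤dx = begin
  B + B                           ≡⟨ budget-split p≤B q≤B ⟩
  (p + (B ∸ q)) + (q + (B ∸ p))   ≤⟨ +-mono-≤ (+-monoˡ-≤ _ p≤dy) (+-monoˡ-≤ _ q≤dx) ⟩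
  (dy + (B ∸ q)) + (dx + (B ∸ p)) ≡⟨ +-comm (dy + (B ∸ q)) _ ⟩
  (dx + (B ∸ p)) + (dy + (B ∸ q)) ∎
  where open ≤-Reasoning

levels-missed : ∀ {B p q dx dy} → p ≤ B → q ≤ B → dy < p → dx < q →
                (dx + (B ∸ p)) + (dy + (B ∸ q)) < B + B
levels-missed {B} {p} {q} {dx} {dy} p≤B q≤B dy<p dx<q = begin-strict
  (dx + (B ∸ p)) + (dy + (B ∸ q)) ≡⟨ +-comm (dx + (B ∸ p)) _ ⟩
  (dy + (B ∸ q)) + (dx + (B ∸ p)) <⟨ +-mono-< (+-monoˡ-< _ dy<p) (+-monoˡ-< _ dx<q) ⟩
  (p + (B ∸ q)) + (q + (B ∸ p))   ≡⟨ budget-split p≤B q≤B ⟨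
  B + B                           ∎
  where open ≤-Reasoning

ι : ℕ → ℚ
ι a = mkℚ (ℤ.+ a) 0 (λ common → ∣1⇒≡1 (proj₂ common))

ι-mono : ∀ {a b} → a ≤ b → ι a ≤ℚ ι b
ι-mono {a} {b} a≤b =
  *≤* (subst₂ ℤ._≤_ (sym (ℤP.*-identityʳ (ℤ.+ a))) (sym (ℤP.*-identityʳ (ℤ.+ b))) (ℤ.+≤+ a≤b))

ι-reflect : ∀ {a b} → ι a ≤ℚ ι b → a ≤ b
ι-reflect {a} {b} (*≤* le) =
  ℤ.drop‿+≤+ (subst₂ ℤ._≤_ (ℤP.*-identityʳ (ℤ.+ a)) (ℤP.*-identityʳ (ℤ.+ b)) le)

ι-+ : ∀ a b → ι a +ℚ ι b ≡ ι (a + b)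
ι-+ a b = ℚP.toℚᵘ-injective (ℚᵘP.≃-trans (ℚP.toℚᵘ-homo-+ (ι a) (ι b)) (ℚᵘ.*≡* cross))
  where
  cross : (ℤ.+ a ℤ.* ℤ.+ 1 ℤ.+ ℤ.+ b ℤ.* ℤ.+ 1) ℤ.* ℤ.+ 1 ≡ ℤ.+ (a + b) ℤ.* (ℤ.+ 1 ℤ.* ℤ.+ 1)
  cross = begin
    (ℤ.+ a ℤ.* ℤ.+ 1 ℤ.+ ℤ.+ b ℤ.* ℤ.+ 1) ℤ.* ℤ.+ 1 ≡⟨ ℤP.*-identityʳ _ ⟩
    ℤ.+ a ℤ.* ℤ.+ 1 ℤ.+ ℤ.+ b ℤ.* ℤ.+ 1            ≡⟨ cong₂ ℤ._+_ (ℤP.*-identityʳ (ℤ.+ a)) (ℤP.*-identityʳ (ℤ.+ b)) ⟩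
    ℤ.+ (a + b)                                    ≡⟨ ℤP.*-identityʳ _ ⟨
    ℤ.+ (a + b) ℤ.* (ℤ.+ 1 ℤ.* ℤ.+ 1)              ∎
    where open ≡-Reasoning

threshold-from-levels : ∀ {n} (G : Adj n) → (∀ x y → G x y ≡ G y x) →
                        (φ d : Fin n → ℕ) (B : ℕ) → (∀ v → φ v ≤ B) →
                        (∀ {x y} → x ≢ y → G x y ≡ true ⇔ φ x ≤ d y) →
                        IsThreshold G
threshold-from-levels {n} G G-sym φ d B φ≤B levels =
  ι ∘ weight , ι (B + B) , λ x y x≢y → mk⇔ (heavy x≢y) (light x≢y)
  where
  weight : Fin n → ℕ
  weight v = d v + (B ∸ φ v)

  below : ∀ {x y} → x ≢ y → G x y ≡ false → d y < φ x
  below x≢y x≁y = ≰⇒> λ φx≤dy →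
    contradiction (trans (sym x≁y) (Equivalence.from (levels x≢y) φx≤dy)) λ ()

  heavy : ∀ {x y} → x ≢ y → G x y ≡ true → ι (B + B) ≤ℚ ι (weight x) +ℚ ι (weight y)
  heavy {x} {y} x≢y x∼y = subst (ι (B + B) ≤ℚ_) (sym (ι-+ (weight x) (weight y))) (ι-mono
    (levels-met (φ≤B x) (φ≤B y) (Equivalence.to (levels x≢y) x∼y)
                (Equivalence.to (levels (x≢y ∘ sym)) (trans (G-sym y x) x∼y))))

  light : ∀ {x y} → x ≢ y → ι (B + B) ≤ℚ ι (weight x) +ℚ ι (weight y) → G x y ≡ true
  light {x} {y} x≢y heavy-pair = ¬-not λ x≁y → <⇒≱
    (levels-missed (φ≤B x) (φ≤B y) (below x≢y x≁y) (below (x≢y ∘ sym) (trans (G-sym y x) x≁y)))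
    (ι-reflect (subst (ι (B + B) ≤ℚ_) (ι-+ (weight x) (weight y)) heavy-pair))

-- Degrees and private neighbourhoods N(x,ȳ), in an arbitrary graph.

module _ {n : ℕ} (G : Adj n) where

  deg-sum : ∀ v → deg G v ≡ sum (λ u → ind (G v u))
  deg-sum v = sum-allFin (λ u → ind (G v u))

  d₂-sum : d₂ G ≡ sum (λ v → square (deg G v))
  d₂-sum = sum-allFin (λ v → square (deg G v))

  privateCount : Fin n → Fin n → ℕ
  privateCount x y = sum (λ v → ind (inN G x y v))

  inN-true : ∀ {x y v} → inN G x y v ≡ true →
             v ≢ x × v ≢ y × G x v ≡ true × G y v ≡ false
  inN-true {x} {y} {v} v∈ with v ≟ x | v ≟ y | G x v | G y v
  ... | no v≢x | no v≢y | true  | false = v≢x , v≢y , refl , refl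
  ... | yes _  | _      | _     | _     = contradiction v∈ λ ()
  ... | no _   | yes _  | _     | _     = contradiction v∈ λ ()
  ... | no _   | no _   | false | _     = contradiction v∈ λ ()
  ... | no _   | no _   | true  | true  = contradiction v∈ λ ()

  inN-intro : ∀ {x y v} → v ≢ x → v ≢ y → G x v ≡ true → G y v ≡ false →
              inN G x y v ≡ true
  inN-intro v≢x v≢y x∼v y≁v rewrite ==-≢ v≢x | ==-≢ v≢y | x∼v | y≁v = refl

  inN-at-x : ∀ {x y} → inN G x y x ≡ false
  inN-at-x {x} {y} = ¬-not λ x∈ → proj₁ (inN-true {x} {y} {x} x∈) refl

  inN-at-y : ∀ {x y} → inN G x y y ≡ false
  inN-at-y {x} {y} = ¬-not λ y∈ → proj₁ (proj₂ (inN-true {x} {y} {y} y∈)) refl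

  privateCount-pos : ∀ {x y w} → inN G x y w ≡ true → 0 < privateCount x y
  privateCount-pos {x} {y} {w} w∈ = subst (_< privateCount x y) (sum-replicate-zero n)
    (sum-mono-< (λ _ → z≤n) w (subst (λ b → 0 < ind b) (sym w∈) (s≤s z≤n)))

  guarded-inN : ∀ (x y u w v : Fin n) → (u == w ∧ inN G x y v) ≡ true →
                u ≡ w × v ≢ x × v ≢ y × G x v ≡ true × G y v ≡ false
  guarded-inN x y u w v h = let (u≡w , v∈) = ==-∧ {u = u} {w} {inN G x y v} h in u≡w , inN-true {x} {y} {v} v∈

Nested : ∀ {n} → Adj n → Set
Nested {n} G = ∀ (x y w b : Fin n) → inN G x y w ≡ true → inN G y x b ≡ true → ⊥

-- Degree balance and compression, in a simple graph.

module _ {n : ℕ} (G : Adj n) (simple : IsSimple G) where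

  private
    G-sym : ∀ x y → G x y ≡ G y x
    G-sym = proj₁ simple

    G-loopless : ∀ x → G x x ≡ false
    G-loopless = proj₂ simple

  -- d(x) + |N(y,x̄)| = d(y) + |N(x,ȳ)|: both count N(x) ∪ N(y) up to the edge xy.
  degree-balance : ∀ {x y} → x ≢ y →
                   deg G x + privateCount G y x ≡ deg G y + privateCount G x y
  degree-balance {x} {y} x≢y = begin
    deg G x + privateCount G y x           ≡⟨ cong (_+ privateCount G y x) (deg-sum G x) ⟩
    sum (λ v → ind (G x v)) + privateCount G y x ≡⟨ ∑-distrib-+ (λ v → ind (G x v)) (λ v → ind (inN G y x v)) ⟨
    sum f                                  ≡⟨ +-cancelʳ-≡ (ind (G x y)) _ _ ends ⟩
    sum g                                  ≡⟨ ∑-distrib-+ (λ v → ind (G y v)) (λ v → ind (inN G x y v)) ⟩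
    sum (λ v → ind (G y v)) + privateCount G x y ≡⟨ cong (_+ privateCount G x y) (deg-sum G y) ⟨
    deg G y + privateCount G x y           ∎
    where
    open ≡-Reasoning
    f g : Fin n → ℕ
    f v = ind (G x v) + ind (inN G y x v)
    g v = ind (G y v) + ind (inN G x y v)

    agree : ∀ v → v ≢ x → v ≢ y → f v ≡ g v
    agree v v≢x v≢y rewrite ==-≢ v≢x | ==-≢ v≢y with G x v | G y v
    ... | true  | true  = refl
    ... | true  | false = refl
    ... | false | true  = refl
    ... | false | false = refl

    f-ends : f x + f y ≡ ind (G x y)
    f-ends rewrite inN-at-y G {y} {x} | inN-at-x G {y} {x} | G-loopless x =
      +-identityʳ (ind (G x y))

    g-ends : g x + g y ≡ ind (G x y)
    g-ends rewrite inN-at-x G {x} {y} | inN-at-y G {x} {y} | G-loopless y | G-sym y x =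
      trans (+-identityʳ _) (+-identityʳ _)

    ends : sum f + ind (G x y) ≡ sum g + ind (G x y)
    ends = begin
      sum f + ind (G x y)   ≡⟨ cong (sum f +_) g-ends ⟨
      sum f + (g x + g y)   ≡⟨ sum-agree-off₂ x≢y agree ⟩
      sum g + (f x + f y)   ≡⟨ cong (sum g +_) f-ends ⟩
      sum g + ind (G x y)   ∎

  degree-gap : ∀ {x y b} → x ≢ y → inN G x y b ≡ true →
               deg G y < deg G x + privateCount G y x
  degree-gap {x} {y} {b} x≢y b∈ = begin-strict
    deg G y                      <⟨ m<m+n (deg G y) (privateCount-pos G {x} {y} {b} b∈) ⟩
    deg G y + privateCount G x y ≡⟨ degree-balance x≢y ⟨
    deg G x + privateCount G y x ∎
    where open ≤-Reasoning

  compress-count : ∀ x y u v →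
    ind (compress G x y u v) + ind (u == x ∧ inN G x y v) + ind (v == x ∧ inN G x y u)
      ≡ ind (G u v) + ind (u == y ∧ inN G x y v) + ind (v == y ∧ inN G x y u)
  compress-count x y u v = begin
    ind C + ind r₁ + ind r₂           ≡⟨ +-assoc (ind C) (ind r₁) (ind r₂) ⟩
    ind C + (ind r₁ + ind r₂)         ≡⟨ cong (ind C +_) (ind-∨ r₁ r₂ r-disjoint) ⟨
    ind C + ind (r₁ ∨ r₂)             ≡⟨ ind-delete-add (G u v) (r₁ ∨ r₂) (a₁ ∨ a₂)
                                           (∨-elim r₁ r₂ r₁⇒edge r₂⇒edge)
                                           (∨-elim a₁ a₂ a₁⇒non-edge a₂⇒non-edge) ⟩
    ind (G u v) + ind (a₁ ∨ a₂)       ≡⟨ cong (ind (G u v) +_) (ind-∨ a₁ a₂ a-disjoint) ⟩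
    ind (G u v) + (ind a₁ + ind a₂)   ≡⟨ +-assoc (ind (G u v)) (ind a₁) (ind a₂) ⟨
    ind (G u v) + ind a₁ + ind a₂     ∎
    where
    open ≡-Reasoning
    C r₁ r₂ a₁ a₂ : Bool
    C  = compress G x y u v
    r₁ = u == x ∧ inN G x y v
    r₂ = v == x ∧ inN G x y u
    a₁ = u == y ∧ inN G x y v
    a₂ = v == y ∧ inN G x y u

    r₁⇒edge : r₁ ≡ true → G u v ≡ true
    r₁⇒edge h = let (u≡x , _ , _ , x∼v , _) = guarded-inN G x y u x v h in
      subst (λ w → G w v ≡ true) (sym u≡x) x∼v
    r₂⇒edge : r₂ ≡ true → G u v ≡ true
    r₂⇒edge h = let (v≡x , _ , _ , x∼u , _) = guarded-inN G x y v x u h in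
      trans (G-sym u v) (subst (λ w → G w u ≡ true) (sym v≡x) x∼u)
    a₁⇒non-edge : a₁ ≡ true → G u v ≡ false
    a₁⇒non-edge h = let (u≡y , _ , _ , _ , y≁v) = guarded-inN G x y u y v h in
      subst (λ w → G w v ≡ false) (sym u≡y) y≁v
    a₂⇒non-edge : a₂ ≡ true → G u v ≡ false
    a₂⇒non-edge h = let (v≡y , _ , _ , _ , y≁u) = guarded-inN G x y v y u h in
      trans (G-sym u v) (subst (λ w → G w u ≡ false) (sym v≡y) y≁u)
    r-disjoint : r₁ ≡ true → r₂ ≡ false
    r-disjoint h = let (_ , v≢x , _) = guarded-inN G x y u x v h in
      cong (_∧ inN G x y u) (==-≢ v≢x)
    a-disjoint : a₁ ≡ true → a₂ ≡ false
    a-disjoint h = let (_ , _ , v≢y , _) = guarded-inN G x y u y v h in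
      cong (_∧ inN G x y u) (==-≢ v≢y)

  compress-degree : ∀ x y u →
    deg (compress G x y) u + (if u == x then privateCount G x y else 0)
      ≡ deg G u + (if u == y then privateCount G x y else 0)
  compress-degree x y u = +-cancelʳ-≡ (ind (A u)) _ _ (begin
    deg C u + (if u == x then a else 0) + ind (A u)
      ≡⟨ cong₂ _+_ (cong₂ _+_ (deg-sum C u) (sym (sum-guard (u == x) A))) (sym (sum-indicator x (A u))) ⟩
    sum (λ v → ind (C u v)) + sum (λ v → ind (u == x ∧ A v)) + sum (λ v → ind (v == x ∧ A u))
      ≡⟨ sum-split₃ (λ v → ind (C u v)) (λ v → ind (u == x ∧ A v)) (λ v → ind (v == x ∧ A u)) ⟨
    sum (λ v → ind (C u v) + ind (u == x ∧ A v) + ind (v == x ∧ A u))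
      ≡⟨ sum-cong-≗ (compress-count x y u) ⟩
    sum (λ v → ind (G u v) + ind (u == y ∧ A v) + ind (v == y ∧ A u))
      ≡⟨ sum-split₃ (λ v → ind (G u v)) (λ v → ind (u == y ∧ A v)) (λ v → ind (v == y ∧ A u)) ⟩
    sum (λ v → ind (G u v)) + sum (λ v → ind (u == y ∧ A v)) + sum (λ v → ind (v == y ∧ A u))
      ≡⟨ cong₂ _+_ (cong₂ _+_ (sym (deg-sum G u)) (sum-guard (u == y) A)) (sum-indicator y (A u)) ⟩
    deg G u + (if u == y then a else 0) + ind (A u) ∎)
    where
    open ≡-Reasoning
    C : Adj n
    C = compress G x y
    A : Fin n → Bool
    A = inN G x y
    a : ℕ
    a = privateCount G x y

  compress-degree-x : ∀ {x y} → x ≢ y →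
                      deg (compress G x y) x + privateCount G x y ≡ deg G x
  compress-degree-x {x} {y} x≢y = trans
    (subst₂ (λ s t → deg (compress G x y) x + s ≡ deg G x + t)
            (guard-true (==-refl x)) (guard-false (==-≢ x≢y)) (compress-degree x y x))
    (+-identityʳ (deg G x))

  compress-degree-y : ∀ {x y} → x ≢ y →
                      deg (compress G x y) y ≡ deg G y + privateCount G x y
  compress-degree-y {x} {y} x≢y = trans
    (sym (+-identityʳ (deg (compress G x y) y)))
    (subst₂ (λ s t → deg (compress G x y) y + s ≡ deg G y + t)
            (guard-false (==-≢ (x≢y ∘ sym))) (guard-true (==-refl y)) (compress-degree x y y))

  compress-degree-other : ∀ {x y u} → u ≢ x → u ≢ y →
                          deg (compress G x y) u ≡ deg G u
  compress-degree-other {x} {y} {u} u≢x u≢y = +-cancelʳ-≡ 0 _ _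
    (subst₂ (λ s t → deg (compress G x y) u + s ≡ deg G u + t)
            (guard-false (==-≢ u≢x)) (guard-false (==-≢ u≢y)) (compress-degree x y u))

  compress-d₂ : ∀ {x y} → x ≢ y →
    d₂ (compress G x y) + (square (deg G x) + square (deg G y))
      ≡ d₂ G + (square (deg (compress G x y) x) + square (deg (compress G x y) y))
  compress-d₂ {x} {y} x≢y = subst₂
    (λ s t → s + (square (deg G x) + square (deg G y))
           ≡ t + (square (deg (compress G x y) x) + square (deg (compress G x y) y)))
    (sym (d₂-sum (compress G x y))) (sym (d₂-sum G))
    (sum-agree-off₂ x≢y λ u u≢x u≢y → cong square (compress-degree-other u≢x u≢y))

  -- If N(x,ȳ) and N(y,x̄) are both non-empty, compressing x → y increases d₂:
  -- with e = d_{G_{x→y}}(x), d = d_G(y) we have e < d and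
  -- d₂ changes by  e² + (d+a)² − (e+a)² − d² > 0.
  compress-increases-d₂ : ∀ {x y w b} → x ≢ y →
    inN G x y w ≡ true → inN G y x b ≡ true → d₂ G < d₂ (compress G x y)
  compress-increases-d₂ {x} {y} {w} {b} x≢y w∈ b∈ =
    +-cancelʳ-< (square (e + a) + square d) (d₂ G) (d₂ C) (begin-strict
      d₂ G + (square (e + a) + square d)
        <⟨ +-monoʳ-< (d₂ G) (square-exchange e<d (privateCount-pos G {x} {y} {w} w∈)) ⟩
      d₂ G + (square e + square (d + a))
        ≡⟨ subst₂ (λ s t → d₂ C + (square s + square d) ≡ d₂ G + (square e + square t))
                  (sym (compress-degree-x x≢y)) (compress-degree-y x≢y) (compress-d₂ x≢y) ⟨
      d₂ C + (square (e + a) + square d) ∎)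
    where
    open ≤-Reasoning
    C : Adj n
    C = compress G x y
    a e d : ℕ
    a = privateCount G x y
    e = deg C x
    d = deg G y
    e<d : e < d
    e<d = +-cancelʳ-< a e d
      (subst (_< d + a) (sym (compress-degree-x x≢y)) (degree-gap {y} {x} {b} (x≢y ∘ sym) b∈))

  compression-stable⇒nested : (∀ x y → d₂ (compress G x y) ≤ d₂ G) → Nested G
  compression-stable⇒nested stable x y w b w∈ b∈ with x ≟ y
  ... | yes refl = -- N(x,x̄) is empty
                   let (_ , _ , x∼w , x≁w) = inN-true G {x} {x} {w} w∈ in
                   contradiction (trans (sym x∼w) x≁w) λ ()
  ... | no  x≢y  = <⇒≱ (compress-increases-d₂ {x} {y} {w} {b} x≢y w∈ b∈) (stable x y)

  -- Nested neighbourhoods give a level description of adjacency.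

  nested-empty : Nested G → ∀ {z y w} → inN G z y w ≡ true → privateCount G y z ≡ 0
  nested-empty nested {z} {y} {w} w∈ = trans
    (sum-cong-≗ λ v → cong ind (¬-not (nested z y w v w∈)))
    (sum-replicate-zero n)

  upward-closed : Nested G → ∀ {x y z} → x ≢ y → G x z ≡ true →
                  deg G z ≤ deg G y → G x y ≡ true
  upward-closed nested {x} {y} {z} x≢y x∼z dz≤dy = ¬-not λ x≁y → <⇒≱ (dy<dz x≁y) dz≤dy
    where
    -- otherwise x is a private neighbour of z against y, and N(y,z̄) = ∅
    dy<dz : G x y ≡ false → deg G y < deg G z
    dy<dz x≁y = subst (deg G y <_) no-private-nbrs (degree-gap {z} {y} {x} z≢y x∈)
      where
      z≢y : z ≢ y
      z≢y z≡y = contradiction (trans (sym x≁y) (subst (λ t → G x t ≡ true) z≡y x∼z)) λ ()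
      x≢z : x ≢ z
      x≢z x≡z = contradiction (trans (sym (G-loopless z)) (subst (λ t → G t z ≡ true) x≡z x∼z)) λ ()
      x∈ : inN G z y x ≡ true
      x∈ = inN-intro G x≢z x≢y (trans (G-sym z x) x∼z) (trans (G-sym y x) x≁y)
      no-private-nbrs : deg G z + privateCount G y z ≡ deg G z
      no-private-nbrs = trans (cong (deg G z +_) (nested-empty nested {z} {y} {x} x∈)) (+-identityʳ _)

  -- Loopless: every degree is below n, so the default level n is never met.
  deg<n : ∀ v → deg G v < n
  deg<n v = subst₂ _<_ (sym (deg-sum G v)) (sum-ones n)
    (sum-mono-< ind≤1 v (subst (λ b → ind b < 1) (sym (G-loopless v)) (s≤s z≤n)))
    where
    ind≤1 : ∀ u → ind (G v u) ≤ 1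
    ind≤1 u with G v u
    ... | true  = ≤-refl
    ... | false = z≤n

  neighbourDegree : Fin n → Fin n → ℕ
  neighbourDegree x z = if G x z then deg G z else n

  lowestNeighbour : Fin n → Fin n
  lowestNeighbour x = argmin (neighbourDegree x) x (allFin n)

  -- φ(x): the least degree of a neighbour of x, or n if x is isolated.
  level : Fin n → ℕ
  level x = neighbourDegree x (lowestNeighbour x)

  level-minimal : ∀ x z → level x ≤ neighbourDegree x z
  level-minimal x z = All.lookup (f[argmin]≤f[xs] {f = neighbourDegree x} x (allFin n)) (∈-allFin z)

  level-of : ∀ {x z b} → G x z ≡ b → neighbourDegree x z ≡ (if b then deg G z else n)
  level-of {x} {z} = cong (λ b → if b then deg G z else n)

  level≤n : ∀ x → level x ≤ n
  level≤n x = subst (level x ≤_) (level-of (G-loopless x)) (level-minimal x x)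

  adjacency-by-level : Nested G → ∀ {x y} → x ≢ y → G x y ≡ true ⇔ level x ≤ deg G y
  adjacency-by-level nested {x} {y} x≢y = mk⇔
    (λ x∼y → subst (level x ≤_) (level-of x∼y) (level-minimal x y))
    reaches
    where
    reaches : level x ≤ deg G y → G x y ≡ true
    reaches φx≤dy with G x (lowestNeighbour x) in x∼z
    ... | true  = upward-closed nested x≢y x∼z φx≤dy
    ... | false = contradiction φx≤dy (<⇒≱ (deg<n y))

corollary2p4 : (n : ℕ) (𝒢 : Adj n → Set)
    → (∀ G′ → 𝒢 G′ → IsSimple G′)
    → (∀ G′ → 𝒢 G′ → ∀ (x y : Fin n) → 𝒢 (compress G′ x y))
    → (G : Adj n) → 𝒢 G
    → (∀ G′ → 𝒢 G′ → d₂ G′ ≤ d₂ G)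
    → IsThreshold G
corollary2p4 n 𝒢 simple closed G G∈𝒢 maximal =
  threshold-from-levels G (proj₁ simpleG) (level G simpleG) (deg G) n
    (level≤n G simpleG) (adjacency-by-level G simpleG nested)
  where
  simpleG : IsSimple G
  simpleG = simple G G∈𝒢

  -- every compression of G stays in 𝒢, so none increases d₂
  nested : Nested G
  nested = compression-stable⇒nested G simpleG
    (λ x y → maximal (compress G x y) (closed G G∈𝒢 x y))
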